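{- Let $\mathfrak M^{\Rightarrow_{A1}}=\langle\mathbf{PP}_6^{\Rightarrow_{A1}},{\uparrow}\mathbf b\rangle$ and let $\mathsf R$ be the Set-Set calculus consisting of the rules $\mathsf r_1$–$\mathsf r_{37}$ together with the three rules $\frac{q}{p\Rightarrow q}$, $\frac{\ }{p,\ p\Rightarrow q}$, $\frac{p,\ p\Rightarrow q}{q}$. Then $\mathsf R$ is $\{p,{\sim}p,\circ p\}$-analytic and $\rhd_{\mathsf R}$ coincides with the Set-Set logic determined by $\mathfrak M^{\Rightarrow_{A1}}$.
   Context: Let $\mathcal{V}_6=\{\hat{\mathbf f},\mathbf f,\mathbf n,\mathbf b,\mathbf t,\hat{\mathbf t}\}$, partially ordered as a bounded distributive lattice by $\hat{\mathbf f}<\mathbf f<\mathbf n<\mathbf t<\hat{\mathbf t}$ and $\mathbf f<\mathbf b<\mathbf t$, with $\mathbf n,\mathbf b$ incomparable. $\mathbf{PP}_6$ is the algebra on $\mathcal V_6$ in the signature $\{\land,\lor,{\sim},\circ,\bot,\top\}$ where $\land,\lor$ are meet and join, $\bot=\hat{\mathbf f}$, $\top=\hat{\mathbf t}$, ${\sim}$ swaps $\mathbf f\leftrightarrow\mathbf t$ and $\hat{\mathbf f}\leftrightarrow\hat{\mathbf t}$ and fixes $\mathbf n,\mathbf b$, and ${\circ}a=\hat{\mathbf t}$ if $a\in\{\hat{\mathbf f},\hat{\mathbf t}\}$, ${\circ}a=\hat{\mathbf f}$ otherwise. ${\uparrow}\mathbf b=\{\mathbf b,\mathbf t,\hat{\mathbf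 t}\}$. $\mathbf{PP}_6^{\Rightarrow_{A1}}$ is the multialgebra expanding $\mathbf{PP}_6$ with the binary multioperation $a\Rightarrow_{A1}b={\uparrow}\mathbf b$ if $a\notin{\uparrow}\mathbf b$ or $b\in{\uparrow}\mathbf b$, and $a\Rightarrow_{A1}b=\mathcal V_6\setminus{\uparrow}\mathbf b$ otherwise. Semantics: formulas are built from a countably infinite set of variables (including $p,q$). A valuation on a PNmatrix $\langle\mathbf A,D\rangle$ (multialgebra plus designated set) is a map $h$ with $h(\copyright(\varphi_1,\dots,\varphi_k))\in\copyright^{\mathbf A}(h(\varphi_1),\dots,h(\varphi_k))$; its Set-Set logic: $\Phi\rhd\Psi$ iff every valuation $h$ has $h(\varphi)\notin D$ for some $\varphi\in\Phi$ or $h(\psi)\in D$ for some $\psi\in\Psi$. Set-Set calculi: a rule $\frac{\Pi}{\Theta}$ is a pair of sets of formulas. For a calculus $\mathsf R$, a derivation is a finite rooted tree whose nodes are labelled by sets of formulas or by $\ast$, such that each non-leaf node labelled $\Gamma$ is expanded by a rule $\frac{\Pi}{\Theta}\in\mathsf R$ and a substitution $\sigma$ with $\sigma(\Pi)\subseteq\Gamma$: its children are nodes labelled $\Gamma\cup\{\theta\}$, one for each $\theta\in\sigma(\Theta)$, if $\Theta\ne\varnothing$, or a single node labelled $\ast$ if $\Theta=\varnothing$. $\Phi\rhd_{\mathsf R}\Psi$ iff there is a derivation whose root label is contained in $\Phi$ and each leaf is labelled $\ast$ or by a set meeting $\Psi$. For $\Lambda$ a set of formulas, $\Phi\rhd^{\Lambda}_{\mathsf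 R}\Psi$ means there is such a derivation using only formulas in $\Lambda$. Given a set $\Xi$ of formulas, for a set $\Gamma$ let $\Upsilon^{\Xi}(\Gamma)$ be the set of subformulas of $\Gamma$ together with all $\sigma(\varphi)$ for $\varphi\in\Xi$ and $\sigma$ a substitution mapping variables to subformulas of $\Gamma$. $\mathsf R$ is $\Xi$-analytic if $\Phi\rhd_{\mathsf R}\Psi$ implies $\Phi\rhd^{\Upsilon^\Xi(\Phi\cup\Psi)}_{\mathsf R}\Psi$. The rules (antecedent/succedent; blank means empty): $\mathsf r_1$: $\frac{}{\top}$; $\mathsf r_2$: $\frac{{\sim}\top}{}$; $\mathsf r_3$: $\frac{}{{\sim}\bot}$; $\mathsf r_4$: $\frac{\bot}{}$; $\mathsf r_5$: $\frac{p}{{\sim}{\sim}p}$; $\mathsf r_6$: $\frac{{\sim}{\sim}p}{p}$; $\mathsf r_7$: $\frac{p\land q}{p}$; $\mathsf r_8$: $\frac{p\land q}{q}$; $\mathsf r_9$: $\frac{p,q}{p\land q}$; $\mathsf r_{10}$: $\frac{{\sim}p}{{\sim}(p\land q)}$; $\mathsf r_{11}$: $\frac{{\sim}q}{{\sim}(p\land q)}$; $\mathsf r_{12}$: $\frac{{\sim}(p\land q)}{{\sim}p,{\sim}q}$; $\mathsf r_{13}$: $\frac{p}{p\lor q}$; $\mathsf r_{14}$: $\frac{q}{p\lor q}$; $\mathsf r_{15}$: $\frac{p\lor q}{p,q}$; $\mathsf r_{16}$: $\frac{{\sim}p,{\sim}q}{{\sim}(p\lor q)}$; $\mathsf r_{17}$: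 $\frac{{\sim}(p\lor q)}{{\sim}p}$; $\mathsf r_{18}$: $\frac{{\sim}(p\lor q)}{{\sim}q}$; $\mathsf r_{19}$: $\frac{}{\circ\bot}$; $\mathsf r_{20}$: $\frac{}{\circ\top}$; $\mathsf r_{21}$: $\frac{}{\circ\circ p}$; $\mathsf r_{22}$: $\frac{\circ p}{\circ{\sim}p}$; $\mathsf r_{23}$: $\frac{\circ{\sim}p}{\circ p}$; $\mathsf r_{24}$: $\frac{\circ p}{p,{\sim}p}$; $\mathsf r_{25}$: $\frac{\circ p,p,{\sim}p}{}$; $\mathsf r_{26}$: $\frac{\circ p}{\circ(p\land q),p}$; $\mathsf r_{27}$: $\frac{\circ q}{\circ(p\land q),q}$; $\mathsf r_{28}$: $\frac{\circ(p\land q),q}{\circ p}$; $\mathsf r_{29}$: $\frac{\circ(p\land q),p}{\circ q}$; $\mathsf r_{30}$: $\frac{\circ p,\circ q}{\circ(p\land q)}$; $\mathsf r_{31}$: $\frac{\circ(p\land q)}{\circ p,\circ q}$; $\mathsf r_{32}$: $\frac{\circ p,\circ q}{\circ(p\lor q)}$; $\mathsf r_{33}$: $\frac{\circ(p\lor q)}{\circ p,\circ q}$; $\mathsf r_{34}$: $\frac{\circ p,p}{\circ(p\lor q)}$; $\mathsf r_{35}$: $\frac{\circ q,q}{\circ(p\lor q)}$; $\mathsf r_{36}$: $\frac{\circ(p\lor q)}{\circ p,q}$; $\mathsf r_{37}$: $\frac{\circ(p\lor q)}{\circ q,p}$. -}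

module Defs where

open import Data.Nat using (ℕ)
open import Data.Bool using (Bool; true; false; not; _∨_; if_then_else_)
open import Data.List using (List; []; _∷_; map)
open import Data.List.Relation.Unary.All using (All)
open import Data.List.Membership.Propositional using (_∈_)
open import Data.Product using (Σ; ∃; _×_; _,_)
open import Data.Sum using (_⊎_)
open import Relation.Nullary using (¬_)
open import Relation.Binary.PropositionalEquality using (_≡_)
open import Relation.Unary using (Pred)
open import Level using (0ℓ)

data V6 : Set where
  f̂ f n b t t̂ : V6

-- the order: f̂ < f < n < t < t̂ , f < b < t , n ∦ b
_≤ᵇ_ : V6 → V6 → Bool
f̂ ≤ᵇ _ = true
f ≤ᵇ f̂ = false
f ≤ᵇ _ = true
n ≤ᵇ n = true
n ≤ᵇ t = true
n ≤ᵇ t̂ = true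
n ≤ᵇ _ = false
b ≤ᵇ b = true
b ≤ᵇ t = true
b ≤ᵇ t̂ = true
b ≤ᵇ _ = false
t ≤ᵇ t = true
t ≤ᵇ t̂ = true
t ≤ᵇ _ = false
t̂ ≤ᵇ t̂ = true
t̂ ≤ᵇ _ = false

-- meet and join of the lattice (the only incomparable pair is n,b,
-- whose meet is f and join is t)
_⊓_ : V6 → V6 → V6
x ⊓ y = if x ≤ᵇ y then x else (if y ≤ᵇ x then y else f)

_⊔_ : V6 → V6 → V6
x ⊔ y = if x ≤ᵇ y then y else (if y ≤ᵇ x then x else t)

∼ᵛ : V6 → V6
∼ᵛ f̂ = t̂
∼ᵛ f = t
∼ᵛ n = n
∼ᵛ b = b
∼ᵛ t = f
∼ᵛ t̂ = f̂

∘ᵛ : V6 → V6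
∘ᵛ f̂ = t̂
∘ᵛ t̂ = t̂
∘ᵛ _ = f̂

inUpB : V6 → Bool
inUpB b = true
inUpB t = true
inUpB t̂ = true
inUpB _ = false

UpB : Pred V6 0ℓ
UpB v = inUpB v ≡ true

-- the multioperation ⇒_A1 : a ⇒ b = ↑b if a ∉ ↑b or b ∈ ↑b,
-- and V6 ∖ ↑b otherwise.  (a ⇒A1 b) c means c ∈ a ⇒A1 b.
_⇒A1_ : V6 → V6 → Pred V6 0ℓ
(x ⇒A1 y) c = if not (inUpB x) ∨ inUpB y then UpB c else ¬ UpB c

infixr 6 _⇒_
infixr 7 _∨ᶠ_
infixr 8 _∧ᶠ_

data Fm : Set where
  var  : ℕ → Fm
  ⊥ᶠ ⊤ᶠ : Fm
  ∼_ ∘_ : Fm → Fm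
  _∧ᶠ_ _∨ᶠ_ _⇒_ : Fm → Fm → Fm

Subst : Set
Subst = ℕ → Fm

sub : Subst → Fm → Fm
sub σ (var x) = σ x
sub σ ⊥ᶠ = ⊥ᶠ
sub σ ⊤ᶠ = ⊤ᶠ
sub σ (∼ φ) = ∼ sub σ φ
sub σ (∘ φ) = ∘ sub σ φ
sub σ (φ ∧ᶠ ψ) = sub σ φ ∧ᶠ sub σ ψ
sub σ (φ ∨ᶠ ψ) = sub σ φ ∨ᶠ sub σ ψ
sub σ (φ ⇒ ψ) = sub σ φ ⇒ sub σ ψ

data _≼_ : Fm → Fm → Set where
  ≼-refl : ∀ {φ} → φ ≼ φ
  ≼-∼   : ∀ {φ ψ} → φ ≼ ψ → φ ≼ (∼ ψ)
  ≼-∘   : ∀ {φ ψ} → φ ≼ ψ → φ ≼ (∘ ψ)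
  ≼-∧ˡ  : ∀ {φ ψ χ} → φ ≼ ψ → φ ≼ (ψ ∧ᶠ χ)
  ≼-∧ʳ  : ∀ {φ ψ χ} → φ ≼ χ → φ ≼ (ψ ∧ᶠ χ)
  ≼-∨ˡ  : ∀ {φ ψ χ} → φ ≼ ψ → φ ≼ (ψ ∨ᶠ χ)
  ≼-∨ʳ  : ∀ {φ ψ χ} → φ ≼ χ → φ ≼ (ψ ∨ᶠ χ)
  ≼-⇒ˡ  : ∀ {φ ψ χ} → φ ≼ ψ → φ ≼ (ψ ⇒ χ)
  ≼-⇒ʳ  : ∀ {φ ψ χ} → φ ≼ χ → φ ≼ (ψ ⇒ χ)

FmSet : Set₁
FmSet = Pred Fm 0ℓ

_∪_ : FmSet → FmSet → FmSet
(Φ ∪ Ψ) φ = Φ φ ⊎ Ψ φ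

record IsValuation (h : Fm → V6) : Set where
  field
    v-⊥ : h ⊥ᶠ ≡ f̂
    v-⊤ : h ⊤ᶠ ≡ t̂
    v-∼ : ∀ φ → h (∼ φ) ≡ ∼ᵛ (h φ)
    v-∘ : ∀ φ → h (∘ φ) ≡ ∘ᵛ (h φ)
    v-∧ : ∀ φ ψ → h (φ ∧ᶠ ψ) ≡ h φ ⊓ h ψ
    v-∨ : ∀ φ ψ → h (φ ∨ᶠ ψ) ≡ h φ ⊔ h ψ
    v-⇒ : ∀ φ ψ → (h φ ⇒A1 h ψ) (h (φ ⇒ ψ))

_▷M_ : FmSet → FmSet → Set
Φ ▷M Ψ = ∀ (h : Fm → V6) → IsValuation h →
           (∃ λ φ → Φ φ × ¬ UpB (h φ)) ⊎ (∃ λ ψ → Ψ ψ × UpB (h ψ))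

-- a rule Π / Θ (finite sets of formulas, given as lists)
record Rule : Set where
  constructor _//_
  field
    prem : List Fm
    conc : List Fm

record Calculus : Set₁ where
  field
    Name : Set
    rule : Name → Rule

-- Deriv R Λ Ψ Γ : there is a derivation tree (in R, using only formulas
-- in Λ) rooted at a node labelled Γ all of whose leaves are labelled ∗
-- or by a set meeting Ψ.  A node labelled Γ is either a leaf meeting Ψ,
-- or is expanded by a rule Π/Θ and substitution σ with σ(Π) ⊆ Γ; its
-- children are Γ ∪ {θ} for θ ∈ σ(Θ) (when Θ = ∅ the single child is ∗,
-- which needs nothing further, matching the empty All below).
data Deriv (R : Calculus) (Λ : FmSet) (Ψ : FmSet) (Γ : List Fm) : Set where
  leaf : ∀ {ψ} → ψ ∈ Γ → Ψ ψ → Deriv R Λ Ψ Γ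
  step : (r : Calculus.Name R) (σ : Subst) →
         All (_∈ Γ) (map (sub σ) (Rule.prem (Calculus.rule R r))) →
         All (λ θ → Λ θ × Deriv R Λ Ψ (θ ∷ Γ))
             (map (sub σ) (Rule.conc (Calculus.rule R r))) →
         Deriv R Λ Ψ Γ

Derivable : Calculus → FmSet → FmSet → FmSet → Set
Derivable R Λ Φ Ψ =
  Σ (List Fm) λ Γ → All Φ Γ × All Λ Γ × Deriv R Λ Ψ Γ

_⊢[_]_ : FmSet → Calculus → FmSet → Set
Φ ⊢[ R ] Ψ = Derivable R (λ _ → Data.Unit.⊤) Φ Ψ
  where import Data.Unit

Υ : List Fm → FmSet → FmSet
Υ Ξ Γ φ =
  (∃ λ ψ → Γ ψ × φ ≼ ψ) ⊎
  (∃ λ ξ → ξ ∈ Ξ × ∃ λ (σ : Subst) →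
      (∀ x → ∃ λ ψ → Γ ψ × σ x ≼ ψ) × φ ≡ sub σ ξ)

Analytic : Calculus → List Fm → Set₁
Analytic R Ξ = ∀ (Φ Ψ : FmSet) → Φ ⊢[ R ] Ψ →
               Derivable R (Υ Ξ (Φ ∪ Ψ)) Φ Ψ

p q : Fm
p = var 0
q = var 1

data RName : Set where
  r1 r2 r3 r4 r5 r6 r7 r8 r9 r10 r11 r12 r13 r14 r15 r16 r17 r18 r19
    r20 r21 r22 r23 r24 r25 r26 r27 r28 r29 r30 r31 r32 r33 r34 r35 r36
    r37 i1 i2 i3 : RName

rulesR : RName → Rule
rulesR r1  = [] // (⊤ᶠ ∷ [])
rulesR r2  = (∼ ⊤ᶠ ∷ []) // []
rulesR r3  = [] // (∼ ⊥ᶠ ∷ [])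
rulesR r4  = (⊥ᶠ ∷ []) // []
rulesR r5  = (p ∷ []) // (∼ ∼ p ∷ [])
rulesR r6  = (∼ ∼ p ∷ []) // (p ∷ [])
rulesR r7  = (p ∧ᶠ q ∷ []) // (p ∷ [])
rulesR r8  = (p ∧ᶠ q ∷ []) // (q ∷ [])
rulesR r9  = (p ∷ q ∷ []) // (p ∧ᶠ q ∷ [])
rulesR r10 = (∼ p ∷ []) // (∼ (p ∧ᶠ q) ∷ [])
rulesR r11 = (∼ q ∷ []) // (∼ (p ∧ᶠ q) ∷ [])
rulesR r12 = (∼ (p ∧ᶠ q) ∷ []) // (∼ p ∷ ∼ q ∷ [])
rulesR r13 = (p ∷ []) // (p ∨ᶠ q ∷ [])
rulesR r14 = (q ∷ []) // (p ∨ᶠ q ∷ [])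
rulesR r15 = (p ∨ᶠ q ∷ []) // (p ∷ q ∷ [])
rulesR r16 = (∼ p ∷ ∼ q ∷ []) // (∼ (p ∨ᶠ q) ∷ [])
rulesR r17 = (∼ (p ∨ᶠ q) ∷ []) // (∼ p ∷ [])
rulesR r18 = (∼ (p ∨ᶠ q) ∷ []) // (∼ q ∷ [])
rulesR r19 = [] // (∘ ⊥ᶠ ∷ [])
rulesR r20 = [] // (∘ ⊤ᶠ ∷ [])
rulesR r21 = [] // (∘ ∘ p ∷ [])
rulesR r22 = (∘ p ∷ []) // (∘ ∼ p ∷ [])
rulesR r23 = (∘ ∼ p ∷ []) // (∘ p ∷ [])
rulesR r24 = (∘ p ∷ []) // (p ∷ ∼ p ∷ [])
rulesR r25 = (∘ p ∷ p ∷ ∼ p ∷ []) // []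
rulesR r26 = (∘ p ∷ []) // (∘ (p ∧ᶠ q) ∷ p ∷ [])
rulesR r27 = (∘ q ∷ []) // (∘ (p ∧ᶠ q) ∷ q ∷ [])
rulesR r28 = (∘ (p ∧ᶠ q) ∷ q ∷ []) // (∘ p ∷ [])
rulesR r29 = (∘ (p ∧ᶠ q) ∷ p ∷ []) // (∘ q ∷ [])
rulesR r30 = (∘ p ∷ ∘ q ∷ []) // (∘ (p ∧ᶠ q) ∷ [])
rulesR r31 = (∘ (p ∧ᶠ q) ∷ []) // (∘ p ∷ ∘ q ∷ [])
rulesR r32 = (∘ p ∷ ∘ q ∷ []) // (∘ (p ∨ᶠ q) ∷ [])
rulesR r33 = (∘ (p ∨ᶠ q) ∷ []) // (∘ p ∷ ∘ q ∷ [])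
rulesR r34 = (∘ p ∷ p ∷ []) // (∘ (p ∨ᶠ q) ∷ [])
rulesR r35 = (∘ q ∷ q ∷ []) // (∘ (p ∨ᶠ q) ∷ [])
rulesR r36 = (∘ (p ∨ᶠ q) ∷ []) // (∘ p ∷ q ∷ [])
rulesR r37 = (∘ (p ∨ᶠ q) ∷ []) // (∘ q ∷ p ∷ [])
rulesR i1  = (q ∷ []) // (p ⇒ q ∷ [])
rulesR i2  = [] // (p ∷ p ⇒ q ∷ [])
rulesR i3  = (p ∷ p ⇒ q ∷ []) // (q ∷ [])

R : Calculus
R = record { Name = RName ; rule = rulesR }

Ξ : List Fm
Ξ = p ∷ ∼ p ∷ ∘ p ∷ []

-- Soundness: every rule of R is respected by the designation pattern of every
-- valuation.  For the rules of the deterministic connectives this is read off the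
-- truth tables; the rules for ⇒ only mention designation, and they say exactly
-- that p ⇒ q is designated iff p is not or q is, which is all ⇒A1 prescribes.
--
-- Analytic completeness: suppose Φ ⊬ Ψ with derivations confined to
-- Λ = Υ^Ξ(Φ ∪ Ψ).  Using cut, compactness of derivations and excluded middle,
-- Lindenbaum's construction extends (Φ, Ψ) to a pair (left, right) covering all
-- formulas with left ⊬ right, so that on Λ the characteristic function of left
-- respects every rule instance.  For a subformula χ of Φ ∪ Ψ the formulas χ, ∼χ
-- and ∘χ are in Λ, and which of them are on the left is a "profile", from which
-- a truth value of χ can be decoded.  The rules of R, read as constraints on
-- profiles, force the profile of a compound formula to decode to the truth table
-- applied to the decoded components (for ⇒ they force just the designation, which
-- is all the multioperation constrains).
-- Decoding thus gives a valuation that designates exactly the left formulas among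
-- the subformulas of Φ ∪ Ψ, so it refutes Φ ▷ Ψ.  Hence every valid Φ ▷ Ψ has a
-- derivation inside Λ, which with soundness gives both completeness and
-- Ξ-analyticity.

module Submission where

open import Defs
open import Level using (0ℓ)
open import Axiom.ExcludedMiddle using (ExcludedMiddle)
open import Data.Bool using (Bool; true; false; not; _∧_; _∨_; T; if_then_else_)
import Data.Bool as Bool
open import Data.Bool.ListAction using (and; or; all; any)
open import Data.Bool.Properties using (T-≡; T-∧)
open import Data.Empty using (⊥-elim)
open import Data.List using (List; []; _∷_; _++_; map; cartesianProductWith)
open import Data.List.Properties using (map-cong-local)
open import Data.List.Membership.Propositional using (_∈_)
open import Data.List.Membership.Propositional.Properties
  using (∈-++⁺ˡ; ∈-++⁺ʳ; ∈-map⁺; ∈-cartesianProductWith⁺)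
open import Data.List.Relation.Binary.Subset.Propositional renaming (_⊆_ to _⊆ᴸ_)
open import Data.List.Relation.Binary.Subset.Propositional.Properties
  using (xs⊆xs++ys; xs⊆ys++xs; ∷⁺ʳ; ∈-∷⁺ʳ; ⊆-trans)
open import Data.List.Relation.Unary.All as All using (All; []; _∷_)
open import Data.List.Relation.Unary.All.Properties as Allₚ using (all⁺; all⁻; ++⁺; anti-mono)
open import Data.List.Relation.Unary.Any using (Any; here; there)
open import Data.List.Relation.Unary.Any.Properties as Anyₚ using (any⁺; any⁻)
open import Data.Nat using (ℕ; zero; suc; _≤_; _≤′_; ≤′-reflexive; ≤′-step) renaming (_⊔_ to _⊔ℕ_)
import Data.Nat as ℕ
open import Data.Nat.Properties using (m≤m⊔n; m≤n⊔m; ≤⇒≤′)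
open import Data.Product using (∃; _×_; _,_; proj₁; proj₂; uncurry)
open import Data.Sum using (_⊎_; inj₁; inj₂)
open import Data.Unit using (tt)
open import Function using (_∘_; id; const; _⇔_; Equivalence)
open import Function.Bundles using (mk↣; mk⇔)
open import Relation.Binary.Core using (Rel)
open import Relation.Binary.Definitions using (DecidableEquality; Reflexive; Transitive)
open import Relation.Binary.PropositionalEquality
  using (_≡_; refl; sym; trans; cong; cong₂; subst; module ≡-Reasoning)
open import Relation.Nullary using (¬_; Dec; yes; no)
open import Relation.Nullary.Decidable
  using (True; isYes; map′; from-yes; toWitness; fromWitness; _×-dec_; _→-dec_; T?; via-injection)
open import Relation.Unary using (_⊆_; _∩_; ｛_｝; ⋃)

Exhaustible : Set → Set₁
Exhaustible A = ∀ {P : A → Set} → (∀ x → Dec (P x)) → Dec (∀ x → P x)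

exhaustible-by : ∀ {A : Set} (xs : List A) → (∀ x → x ∈ xs) → Exhaustible A
exhaustible-by xs complete P? =
  map′ (λ ps x → All.lookup ps (complete x)) (λ p → All.tabulate (λ {x} _ → p x)) (All.all? P? xs)

exhaustible-× : ∀ {A B : Set} → Exhaustible A → Exhaustible B → Exhaustible (A × B)
exhaustible-× ∀A? ∀B? P? =
  map′ (λ p (x , y) → p x y) (λ p x y → p (x , y)) (∀A? λ x → ∀B? λ y → P? (x , y))

_⇔-dec_ : ∀ {A B : Set} → Dec A → Dec B → Dec (A ⇔ B)
A? ⇔-dec B? = map′ (uncurry mk⇔) (λ A⇔B → Equivalence.to A⇔B , Equivalence.from A⇔B)
                   ((A? →-dec B?) ×-dec (B? →-dec A?))

exhaustible-Bool : Exhaustible Bool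
exhaustible-Bool = exhaustible-by (true ∷ false ∷ []) λ where
  true → here refl
  false → there (here refl)

exhaustible-V6 : Exhaustible V6
exhaustible-V6 = exhaustible-by (f̂ ∷ f ∷ n ∷ b ∷ t ∷ t̂ ∷ []) λ where
  f̂ → here refl
  f → there (here refl)
  n → there (there (here refl))
  b → there (there (there (here refl)))
  t → there (there (there (there (here refl))))
  t̂ → there (there (there (there (there (here refl)))))

index : V6 → ℕ
index f̂ = 0
index f = 1
index n = 2
index b = 3
index t = 4
index t̂ = 5

fromIndex : ℕ → V6
fromIndex 0 = f̂
fromIndex 1 = f
fromIndex 2 = n
fromIndex 3 = b
fromIndex 4 = t
fromIndex _ = t̂

fromIndex-index : ∀ v → fromIndex (index v) ≡ v
fromIndex-index f̂ = refl
fromIndex-index f = refl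
fromIndex-index n = refl
fromIndex-index b = refl
fromIndex-index t = refl
fromIndex-index t̂ = refl

_≟_ : DecidableEquality V6
_≟_ = via-injection (mk↣ index-injective) ℕ._≟_
  where
  index-injective : ∀ {v w} → index v ≡ index w → v ≡ w
  index-injective {v} {w} eq = trans (sym (fromIndex-index v)) (trans (cong fromIndex eq) (fromIndex-index w))

Holds : (Fm → Bool) → Rule → Set
Holds E ρ = T (all E (Rule.prem ρ)) → T (any E (Rule.conc ρ))

holds? : ∀ E ρ → Dec (Holds E ρ)
holds? E ρ = T? _ →-dec T? _

increasing-by-steps : ∀ {a ℓ} {X : Set a} (_≲_ : Rel X ℓ) → Reflexive _≲_ → Transitive _≲_ →
                      (g : ℕ → X) → (∀ d → g d ≲ g (suc d)) → ∀ {d d'} → d ≤ d' → g d ≲ g d'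
increasing-by-steps _≲_ ≲-refl ≲-trans g grows = go ∘ ≤⇒≤′
  where
  go : ∀ {d d'} → d ≤′ d' → g d ≲ g d'
  go (≤′-reflexive refl) = ≲-refl
  go (≤′-step d≤′d') = ≲-trans (go d≤′d') (grows _)

Increasing : (ℕ → FmSet) → Set
Increasing A = ∀ {d d'} → d ≤ d' → A d ⊆ A d'

separate : ∀ {A : FmSet} {φ} Γ → All (A ∪ ｛ φ ｝) Γ → ∃ λ Γ' → Γ' ⊆ᴸ Γ × All A Γ' × Γ ⊆ᴸ φ ∷ Γ'
separate [] [] = [] , (λ ()) , [] , (λ ())
separate (χ ∷ Γ) (inj₁ Aχ ∷ A∪φ-Γ) with separate Γ A∪φ-Γ
... | Γ' , Γ'⊆Γ , A-Γ' , Γ⊆φ∷Γ' = χ ∷ Γ' , ∷⁺ʳ χ Γ'⊆Γ , Aχ ∷ A-Γ' , λ where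
  (here refl) → there (here refl)
  (there ψ∈Γ) → ∈-∷⁺ʳ (here refl) (there ∘ there) (Γ⊆φ∷Γ' ψ∈Γ)
separate (χ ∷ Γ) (inj₂ refl ∷ A∪φ-Γ) with separate Γ A∪φ-Γ
... | Γ' , Γ'⊆Γ , A-Γ' , Γ⊆φ∷Γ' = Γ' , there ∘ Γ'⊆Γ , A-Γ' , ∈-∷⁺ʳ (here refl) Γ⊆φ∷Γ'

module _ {C : Calculus} where

  module _ (E : Fm → Bool) (rules-hold : ∀ r σ → Holds (E ∘ sub σ) (Calculus.rule C r)) where

    mutual
      deriv-sound : ∀ {Λ Ψ Γ} → Deriv C Λ Ψ Γ → All (T ∘ E) Γ → ∃ λ ψ → Ψ ψ × T (E ψ)
      deriv-sound (leaf ψ∈Γ Ψψ) designated = _ , Ψψ , All.lookup designated ψ∈Γ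
      deriv-sound (step r σ premises children) designated =
        children-sound (Anyₚ.map⁺ (any⁻ (E ∘ sub σ) _ (rules-hold r σ premises-designated)))
                       children designated
        where
        premises-designated : T (all (E ∘ sub σ) (Rule.prem (Calculus.rule C r)))
        premises-designated = all⁻ (E ∘ sub σ) (Allₚ.map⁻ (All.map (All.lookup designated) premises))

      children-sound : ∀ {Λ Ψ Γ θs} → Any (T ∘ E) θs → All (λ θ → Λ θ × Deriv C Λ Ψ (θ ∷ Γ)) θs →
                       All (T ∘ E) Γ → ∃ λ ψ → Ψ ψ × T (E ψ)
      children-sound (here Eθ) ((_ , d) ∷ _) designated = deriv-sound d (Eθ ∷ designated)
      children-sound (there i) (_ ∷ ds) designated = children-sound i ds designated

    derivable-sound : ∀ {Λ Φ Ψ} → Derivable C Λ Φ Ψ →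
                      (∃ λ φ → Φ φ × ¬ T (E φ)) ⊎ (∃ λ ψ → Ψ ψ × T (E ψ))
    derivable-sound (Γ , Φ-Γ , _ , d) with All.all? (T? ∘ E) Γ
    ... | yes designated = inj₂ (deriv-sound d designated)
    ... | no undesignated = inj₁ (_ , All.lookupAny Φ-Γ (Allₚ.¬All⇒Any¬ (T? ∘ E) Γ undesignated))

  mutual
    deriv-mono : ∀ {Λ Λ' Ψ Ψ' Γ Γ'} → Λ ⊆ Λ' → Ψ ⊆ Ψ' → Γ ⊆ᴸ Γ' →
                 Deriv C Λ Ψ Γ → Deriv C Λ' Ψ' Γ'
    deriv-mono _ Ψ⊆ Γ⊆ (leaf ψ∈Γ Ψψ) = leaf (Γ⊆ ψ∈Γ) (Ψ⊆ Ψψ)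
    deriv-mono Λ⊆ Ψ⊆ Γ⊆ (step r σ premises children) =
      step r σ (All.map Γ⊆ premises) (children-mono Λ⊆ Ψ⊆ Γ⊆ children)

    children-mono : ∀ {Λ Λ' Ψ Ψ' Γ Γ' θs} → Λ ⊆ Λ' → Ψ ⊆ Ψ' → Γ ⊆ᴸ Γ' →
                    All (λ θ → Λ θ × Deriv C Λ Ψ (θ ∷ Γ)) θs →
                    All (λ θ → Λ' θ × Deriv C Λ' Ψ' (θ ∷ Γ')) θs
    children-mono Λ⊆ Ψ⊆ Γ⊆ [] = []
    children-mono Λ⊆ Ψ⊆ Γ⊆ ((Λθ , d) ∷ ds) =
      (Λ⊆ Λθ , deriv-mono Λ⊆ Ψ⊆ (∷⁺ʳ _ Γ⊆) d) ∷ children-mono Λ⊆ Ψ⊆ Γ⊆ ds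

  derivable-mono : ∀ {Λ Λ' Φ Φ' Ψ Ψ'} → Λ ⊆ Λ' → Φ ⊆ Φ' → Ψ ⊆ Ψ' →
                   Derivable C Λ Φ Ψ → Derivable C Λ' Φ' Ψ'
  derivable-mono Λ⊆ Φ⊆ Ψ⊆ (Γ , Φ-Γ , Λ-Γ , d) =
    Γ , All.map Φ⊆ Φ-Γ , All.map Λ⊆ Λ-Γ , deriv-mono Λ⊆ Ψ⊆ id d

  module _ {Λ Ψ : FmSet} {φ : Fm} {Γ₀ : List Fm}
           (at-φ : ∀ {Δ} → Γ₀ ⊆ᴸ Δ → φ ∈ Δ → Deriv C Λ Ψ Δ) where
    mutual
      graft : ∀ {Δ} → Γ₀ ⊆ᴸ Δ → Deriv C Λ (Ψ ∪ ｛ φ ｝) Δ → Deriv C Λ Ψ Δ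
      graft Γ₀⊆Δ (leaf ψ∈Δ (inj₁ Ψψ)) = leaf ψ∈Δ Ψψ
      graft Γ₀⊆Δ (leaf φ∈Δ (inj₂ refl)) = at-φ Γ₀⊆Δ φ∈Δ
      graft Γ₀⊆Δ (step r σ premises children) = step r σ premises (graft-children Γ₀⊆Δ children)

      graft-children : ∀ {Δ θs} → Γ₀ ⊆ᴸ Δ → All (λ θ → Λ θ × Deriv C Λ (Ψ ∪ ｛ φ ｝) (θ ∷ Δ)) θs →
                       All (λ θ → Λ θ × Deriv C Λ Ψ (θ ∷ Δ)) θs
      graft-children Γ₀⊆Δ [] = []
      graft-children Γ₀⊆Δ ((Λθ , d) ∷ ds) = (Λθ , graft (there ∘ Γ₀⊆Δ) d) ∷ graft-children Γ₀⊆Δ ds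

  cut : ∀ {Λ Φ Ψ φ} → Derivable C Λ Φ (Ψ ∪ ｛ φ ｝) → Derivable C Λ (Φ ∪ ｛ φ ｝) Ψ →
        Derivable C Λ Φ Ψ
  cut (Γ₁ , Φ-Γ₁ , Λ-Γ₁ , d₁) (Γ₂ , Φφ-Γ₂ , Λ-Γ₂ , d₂) with separate Γ₂ Φφ-Γ₂
  ... | Γ₂' , Γ₂'⊆Γ₂ , Φ-Γ₂' , Γ₂⊆φ∷Γ₂' =
    Γ₁ ++ Γ₂' , ++⁺ Φ-Γ₁ Φ-Γ₂' , ++⁺ Λ-Γ₁ (anti-mono Γ₂'⊆Γ₂ Λ-Γ₂) ,
    graft (λ Γ₂'⊆Δ φ∈Δ → deriv-mono id id (⊆-trans Γ₂⊆φ∷Γ₂' (∈-∷⁺ʳ φ∈Δ Γ₂'⊆Δ)) d₂)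
          (xs⊆ys++xs Γ₂' Γ₁) (deriv-mono id id (xs⊆xs++ys Γ₁ Γ₂') d₁)

  module _ {Λ : FmSet} {Ψ : ℕ → FmSet} (Ψ↑ : Increasing Ψ) where
    mutual
      deriv-compact : ∀ {Γ} → Deriv C Λ (⋃ ℕ Ψ) Γ → ∃ λ d → Deriv C Λ (Ψ d) Γ
      deriv-compact (leaf ψ∈Γ (d , Ψdψ)) = d , leaf ψ∈Γ Ψdψ
      deriv-compact (step r σ premises children) with children-compact children
      ... | d , children' = d , step r σ premises children'

      children-compact : ∀ {Γ θs} → All (λ θ → Λ θ × Deriv C Λ (⋃ ℕ Ψ) (θ ∷ Γ)) θs →
                         ∃ λ d → All (λ θ → Λ θ × Deriv C Λ (Ψ d) (θ ∷ Γ)) θs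
      children-compact [] = 0 , []
      children-compact ((Λθ , d) ∷ ds) with deriv-compact d | children-compact ds
      ... | k , d' | l , ds' = k ⊔ℕ l , (Λθ , deriv-mono id (Ψ↑ (m≤m⊔n k l)) id d')
                                      ∷ children-mono id (Ψ↑ (m≤n⊔m k l)) id ds'

  all-compact : ∀ {Φ : ℕ → FmSet} → Increasing Φ → ∀ {Γ} → All (⋃ ℕ Φ) Γ → ∃ λ d → All (Φ d) Γ
  all-compact Φ↑ [] = 0 , []
  all-compact Φ↑ ((k , Φkχ) ∷ Φ-Γ) with all-compact Φ↑ Φ-Γ
  ... | l , Φl-Γ = k ⊔ℕ l , Φ↑ (m≤m⊔n k l) Φkχ ∷ All.map (Φ↑ (m≤n⊔m k l)) Φl-Γ

  derivable-compact : ∀ {Λ} {Φ Ψ : ℕ → FmSet} → Increasing Φ → Increasing Ψ →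
                      Derivable C Λ (⋃ ℕ Φ) (⋃ ℕ Ψ) → ∃ λ d → Derivable C Λ (Φ d) (Ψ d)
  derivable-compact Φ↑ Ψ↑ (Γ , Φ-Γ , Λ-Γ , d) with all-compact Φ↑ Φ-Γ | deriv-compact Ψ↑ d
  ... | k , Φk-Γ | l , dl =
    k ⊔ℕ l , Γ , All.map (Φ↑ (m≤m⊔n k l)) Φk-Γ , Λ-Γ , deriv-mono id (Ψ↑ (m≤n⊔m k l)) id dl

-- Lindenbaum's lemma

newFormulas : ℕ → List Fm → List Fm
newFormulas d A = var d ∷ ⊥ᶠ ∷ ⊤ᶠ ∷ map ∼_ A ++ map ∘_ A ++ cartesianProductWith _∧ᶠ_ A A
                  ++ cartesianProductWith _∨ᶠ_ A A ++ cartesianProductWith _⇒_ A A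

formulas : ℕ → List Fm
formulas zero = []
formulas (suc d) = formulas d ++ newFormulas d (formulas d)

formulas-increasing : ∀ {d d'} → d ≤ d' → formulas d ⊆ᴸ formulas d'
formulas-increasing = increasing-by-steps _⊆ᴸ_ id (λ ⊆₁ ⊆₂ → ⊆₂ ∘ ⊆₁) formulas (λ d → xs⊆xs++ys _ _)

newFormulas⊆formulas : ∀ d → newFormulas d (formulas d) ⊆ᴸ formulas (suc d)
newFormulas⊆formulas d = xs⊆ys++xs _ (formulas d)

binary-cover : (_⊙_ : Fm → Fm → Fm) → (∀ {d A φ ψ} → φ ∈ A → ψ ∈ A → φ ⊙ ψ ∈ newFormulas d A) →
               ∀ {φ ψ} → (∃ λ d → φ ∈ formulas d) → (∃ λ d → ψ ∈ formulas d) →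
               ∃ λ d → φ ⊙ ψ ∈ formulas d
binary-cover _⊙_ ⊙-new (k , φ∈) (l , ψ∈) =
  suc (k ⊔ℕ l) , newFormulas⊆formulas (k ⊔ℕ l)
                   (⊙-new (formulas-increasing (m≤m⊔n k l) φ∈) (formulas-increasing (m≤n⊔m k l) ψ∈))

formulas-cover : ∀ φ → ∃ λ d → φ ∈ formulas d
formulas-cover (var x) = suc x , newFormulas⊆formulas x (here refl)
formulas-cover ⊥ᶠ = 1 , there (here refl)
formulas-cover ⊤ᶠ = 1 , there (there (here refl))
formulas-cover (∼ φ) with formulas-cover φ
... | d , φ∈ = suc d , newFormulas⊆formulas d (there (there (there (∈-++⁺ˡ (∈-map⁺ ∼_ φ∈)))))
formulas-cover (∘ φ) with formulas-cover φ
... | d , φ∈ = suc d , newFormulas⊆formulas d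
                         (there (there (there (∈-++⁺ʳ (map ∼_ (formulas d)) (∈-++⁺ˡ (∈-map⁺ ∘_ φ∈))))))
formulas-cover (φ ∧ᶠ ψ) = binary-cover _∧ᶠ_ (λ {_} {A} φ∈ ψ∈ → there (there (there
  (∈-++⁺ʳ (map ∼_ A) (∈-++⁺ʳ (map ∘_ A) (∈-++⁺ˡ (∈-cartesianProductWith⁺ _∧ᶠ_ φ∈ ψ∈)))))))
  (formulas-cover φ) (formulas-cover ψ)
formulas-cover (φ ∨ᶠ ψ) = binary-cover _∨ᶠ_ (λ {_} {A} φ∈ ψ∈ → there (there (there
  (∈-++⁺ʳ (map ∼_ A) (∈-++⁺ʳ (map ∘_ A) (∈-++⁺ʳ (cartesianProductWith _∧ᶠ_ A A)
  (∈-++⁺ˡ (∈-cartesianProductWith⁺ _∨ᶠ_ φ∈ ψ∈))))))))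
  (formulas-cover φ) (formulas-cover ψ)
formulas-cover (φ ⇒ ψ) = binary-cover _⇒_ (λ {_} {A} φ∈ ψ∈ → there (there (there
  (∈-++⁺ʳ (map ∼_ A) (∈-++⁺ʳ (map ∘_ A) (∈-++⁺ʳ (cartesianProductWith _∧ᶠ_ A A)
  (∈-++⁺ʳ (cartesianProductWith _∨ᶠ_ A A) (∈-cartesianProductWith⁺ _⇒_ φ∈ ψ∈))))))))
  (formulas-cover φ) (formulas-cover ψ)

record Partition (C : Calculus) (Λ Φ Ψ : FmSet) : Set₁ where
  field
    left right : FmSet
    Φ⊆left : Φ ⊆ left
    Ψ⊆right : Ψ ⊆ right
    left-or-right : ∀ φ → left φ ⊎ right φ
    underivable : ¬ Derivable C Λ left right

module Lindenbaum (em : ExcludedMiddle 0ℓ) (C : Calculus) (Λ Φ Ψ : FmSet) where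

  State : Set₁
  State = FmSet × FmSet

  Underivable : State → Set
  Underivable (A , B) = ¬ Derivable C Λ A B

  _⊑_ : State → State → Set
  (A , B) ⊑ (A' , B') = A ⊆ A' × B ⊆ B'

  ⊑-trans : Transitive _⊑_
  ⊑-trans (A⊆ , B⊆) (A'⊆ , B'⊆) = A'⊆ ∘ A⊆ , B'⊆ ∘ B⊆

  place : Fm → State → State
  place φ (A , B) with em {Derivable C Λ (A ∪ ｛ φ ｝) B}
  ... | yes _ = A , B ∪ ｛ φ ｝
  ... | no _ = A ∪ ｛ φ ｝ , B

  place-underivable : ∀ φ s → Underivable s → Underivable (place φ s)
  place-underivable φ (A , B) underivable with em {Derivable C Λ (A ∪ ｛ φ ｝) B}
  ... | yes left-derivable = λ right-derivable → underivable (cut right-derivable left-derivable)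
  ... | no left-underivable = left-underivable

  place-grows : ∀ φ s → s ⊑ place φ s
  place-grows φ (A , B) with em {Derivable C Λ (A ∪ ｛ φ ｝) B}
  ... | yes _ = id , inj₁
  ... | no _ = inj₁ , id

  place-places : ∀ φ s → proj₁ (place φ s) φ ⊎ proj₂ (place φ s) φ
  place-places φ (A , B) with em {Derivable C Λ (A ∪ ｛ φ ｝) B}
  ... | yes _ = inj₂ (inj₂ refl)
  ... | no _ = inj₁ (inj₂ refl)

  placeAll : List Fm → State → State
  placeAll [] s = s
  placeAll (φ ∷ φs) s = placeAll φs (place φ s)

  placeAll-underivable : ∀ φs s → Underivable s → Underivable (placeAll φs s)
  placeAll-underivable [] s = id
  placeAll-underivable (φ ∷ φs) s = placeAll-underivable φs (place φ s) ∘ place-underivable φ s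

  placeAll-grows : ∀ φs s → s ⊑ placeAll φs s
  placeAll-grows [] s = id , id
  placeAll-grows (φ ∷ φs) s = ⊑-trans (place-grows φ s) (placeAll-grows φs (place φ s))

  placeAll-places : ∀ {φ} φs s → φ ∈ φs → proj₁ (placeAll φs s) φ ⊎ proj₂ (placeAll φs s) φ
  placeAll-places {φ} (_ ∷ φs) s (here refl) with placeAll-grows φs (place φ s) | place-places φ s
  ... | A⊆ , _ | inj₁ left = inj₁ (A⊆ left)
  ... | _ , B⊆ | inj₂ right = inj₂ (B⊆ right)
  placeAll-places (ψ ∷ φs) s (there φ∈) = placeAll-places φs (place ψ s) φ∈

  stage : ℕ → State
  stage zero = Φ , Ψ
  stage (suc d) = placeAll (formulas d) (stage d)

  stage-grows : ∀ {d d'} → d ≤ d' → stage d ⊑ stage d'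
  stage-grows = increasing-by-steps _⊑_ (id , id) ⊑-trans stage λ d → placeAll-grows (formulas d) (stage d)

  lindenbaum : ¬ Derivable C Λ Φ Ψ → Partition C Λ Φ Ψ
  lindenbaum underivable = record
    { left = ⋃ ℕ (proj₁ ∘ stage)
    ; right = ⋃ ℕ (proj₂ ∘ stage)
    ; Φ⊆left = 0 ,_
    ; Ψ⊆right = 0 ,_
    ; left-or-right = left-or-right
    ; underivable =
        uncurry stage-underivable ∘ derivable-compact (proj₁ ∘ stage-grows) (proj₂ ∘ stage-grows)
    }
    where
    stage-underivable : ∀ d → Underivable (stage d)
    stage-underivable zero = underivable
    stage-underivable (suc d) = placeAll-underivable (formulas d) (stage d) (stage-underivable d)

    left-or-right : ∀ φ → ⋃ ℕ (proj₁ ∘ stage) φ ⊎ ⋃ ℕ (proj₂ ∘ stage) φ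
    left-or-right φ with formulas-cover φ
    ... | d , φ∈ with placeAll-places (formulas d) (stage d) φ∈
    ... | inj₁ left = inj₁ (suc d , left)
    ... | inj₂ right = inj₂ (suc d , right)

module LeftSide (em : ExcludedMiddle 0ℓ) {C : Calculus} {Λ Φ Ψ : FmSet}
                (partition : Partition C Λ Φ Ψ) where
  open Partition partition public

  onLeft : Fm → Bool
  onLeft χ = isYes (em {(left ∩ Λ) χ})

  onLeft⇒left : ∀ {χ} → T (onLeft χ) → (left ∩ Λ) χ
  onLeft⇒left = toWitness {a? = em}

  left⇒onLeft : ∀ {χ} → (left ∩ Λ) χ → T (onLeft χ)
  left⇒onLeft = fromWitness {a? = em}

  ¬onLeft⇒right : ∀ {χ} → Λ χ → ¬ T (onLeft χ) → right χ
  ¬onLeft⇒right {χ} Λχ ¬onLeftχ with left-or-right χ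
  ... | inj₁ leftχ = ⊥-elim (¬onLeftχ (left⇒onLeft (leftχ , Λχ)))
  ... | inj₂ rightχ = rightχ

  onLeft-respects : ∀ r σ → All Λ (map (sub σ) (Rule.conc (Calculus.rule C r))) →
                    Holds (onLeft ∘ sub σ) (Calculus.rule C r)
  onLeft-respects r σ Λ-conclusions premises-on-left
    with T? (any (onLeft ∘ sub σ) (Rule.conc (Calculus.rule C r)))
  ... | yes some-conclusion-on-left = some-conclusion-on-left
  ... | no no-conclusion-on-left = ⊥-elim (underivable
          (_ , All.map (proj₁ ∘ onLeft⇒left) premises , All.map (proj₂ ∘ onLeft⇒left) premises ,
           step r σ (All.tabulate id) (All.zipWith right-leaf (Λ-conclusions , conclusions))))
    where
    premises : All (T ∘ onLeft) (map (sub σ) (Rule.prem (Calculus.rule C r)))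
    premises = Allₚ.map⁺ (all⁺ (onLeft ∘ sub σ) _ premises-on-left)

    conclusions : All (¬_ ∘ T ∘ onLeft) (map (sub σ) (Rule.conc (Calculus.rule C r)))
    conclusions = Allₚ.map⁺ (Allₚ.¬Any⇒All¬ _ (no-conclusion-on-left ∘ any⁺ (onLeft ∘ sub σ)))

    right-leaf : ∀ {θ} → Λ θ × ¬ T (onLeft θ) →
                 Λ θ × Deriv C Λ right (θ ∷ map (sub σ) (Rule.prem (Calculus.rule C r)))
    right-leaf (Λθ , ¬onLeftθ) = Λθ , leaf (here refl) (¬onLeft⇒right Λθ ¬onLeftθ)

-- Rules of R as constraints on profiles

AllHold : (Fm → Bool) → List RName → Set
AllHold E = All (λ r → Holds E (rulesR r))

allHold? : ∀ E rs → Dec (AllHold E rs)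
allHold? E = All.all? (λ r → holds? E (rulesR r))

Profile : Set
Profile = Bool × Bool × Bool

profileUnder : (Fm → Bool) → Fm → Profile
profileUnder E χ = E χ , E (∼ χ) , E (∘ χ)

exhaustible-Profile : Exhaustible Profile
exhaustible-Profile = exhaustible-× exhaustible-Bool (exhaustible-× exhaustible-Bool exhaustible-Bool)

-- Inverts the profile of a value: ∘v is designated exactly for the classical
-- values f̂, t̂, which designation tells apart; the other four are told apart by
-- the designation of v and ∼v.
decode : Profile → V6
decode (a , _ , true) = if a then t̂ else f̂
decode (true , true , false) = b
decode (true , false , false) = t
decode (false , true , false) = f
decode (false , false , false) = n

decode-designation : ∀ C → inUpB (decode C) ≡ proj₁ C
decode-designation = from-yes (exhaustible-Profile λ C → inUpB (decode C) Bool.≟ proj₁ C)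

-- Every formula in the rules of one connective is χ, ∼χ or ∘χ with χ among p, q
-- and the compound formula, so the profiles of these three fix an assignment on
-- all of them.
profileOf : Profile → Profile → Profile → Fm → Profile
profileOf P Q C (var zero) = P
profileOf P Q C (var (suc _)) = Q
profileOf P Q C _ = C

patternAssignment : Profile → Profile → Profile → Fm → Bool
patternAssignment P Q C (∼ χ) = proj₁ (proj₂ (profileOf P Q C χ))
patternAssignment P Q C (∘ χ) = proj₂ (proj₂ (profileOf P Q C χ))
patternAssignment P Q C χ = proj₁ (profileOf P Q C χ)

Coherent : Profile → Set
Coherent C = AllHold (patternAssignment C C C) (r24 ∷ r25 ∷ [])

coherent? : ∀ C → Dec (Coherent C)
coherent? C = allHold? (patternAssignment C C C) (r24 ∷ r25 ∷ [])

∧-rules ∨-rules ∼-rules ⇒-rules : List RName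
∧-rules = r7 ∷ r8 ∷ r9 ∷ r10 ∷ r11 ∷ r12 ∷ r26 ∷ r27 ∷ r28 ∷ r29 ∷ r30 ∷ r31 ∷ []
∨-rules = r13 ∷ r14 ∷ r15 ∷ r16 ∷ r17 ∷ r18 ∷ r32 ∷ r33 ∷ r34 ∷ r35 ∷ r36 ∷ r37 ∷ []
∼-rules = r5 ∷ r6 ∷ r22 ∷ r23 ∷ []
⇒-rules = i1 ∷ i2 ∷ i3 ∷ []

⊥-rules-force : ∀ C → AllHold (patternAssignment C C C) (r4 ∷ r19 ∷ []) → decode C ≡ f̂
⊥-rules-force = from-yes (exhaustible-Profile λ C →
  allHold? (patternAssignment C C C) (r4 ∷ r19 ∷ []) →-dec (decode C ≟ f̂))

⊤-rules-force : ∀ C → AllHold (patternAssignment C C C) (r1 ∷ r20 ∷ []) → decode C ≡ t̂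
⊤-rules-force = from-yes (exhaustible-Profile λ C →
  allHold? (patternAssignment C C C) (r1 ∷ r20 ∷ []) →-dec (decode C ≟ t̂))

∼-rules-force : ∀ a a' a° c' c° → Coherent (a , a' , a°) →
  AllHold (patternAssignment (a , a' , a°) (a , a' , a°) (a' , c' , c°)) ∼-rules →
  decode (a' , c' , c°) ≡ ∼ᵛ (decode (a , a' , a°))
∼-rules-force = from-yes (exhaustible-Bool λ a → exhaustible-Bool λ a' → exhaustible-Bool λ a° →
  exhaustible-Bool λ c' → exhaustible-Bool λ c° → coherent? (a , a' , a°) →-dec
  allHold? (patternAssignment (a , a' , a°) (a , a' , a°) (a' , c' , c°)) ∼-rules →-dec
  (decode (a' , c' , c°) ≟ ∼ᵛ (decode (a , a' , a°))))

∘-rules-force : ∀ a a' a° e' e° →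
  AllHold (patternAssignment (a , a' , a°) (a , a' , a°) (a° , e' , e°)) (r21 ∷ []) →
  decode (a° , e' , e°) ≡ ∘ᵛ (decode (a , a' , a°))
∘-rules-force = from-yes (exhaustible-Bool λ a → exhaustible-Bool λ a' → exhaustible-Bool λ a° →
  exhaustible-Bool λ e' → exhaustible-Bool λ e° →
  allHold? (patternAssignment (a , a' , a°) (a , a' , a°) (a° , e' , e°)) (r21 ∷ []) →-dec
  (decode (a° , e' , e°) ≟ ∘ᵛ (decode (a , a' , a°))))

∧-rules-force : ∀ P Q C → Coherent P → Coherent Q → Coherent C →
  AllHold (patternAssignment P Q C) ∧-rules → decode C ≡ decode P ⊓ decode Q
∧-rules-force = from-yes (exhaustible-Profile λ P → exhaustible-Profile λ Q → exhaustible-Profile λ C →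
  coherent? P →-dec coherent? Q →-dec coherent? C →-dec
  allHold? (patternAssignment P Q C) ∧-rules →-dec (decode C ≟ (decode P ⊓ decode Q)))

∨-rules-force : ∀ P Q C → Coherent P → Coherent Q → Coherent C →
  AllHold (patternAssignment P Q C) ∨-rules → decode C ≡ decode P ⊔ decode Q
∨-rules-force = from-yes (exhaustible-Profile λ P → exhaustible-Profile λ Q → exhaustible-Profile λ C →
  coherent? P →-dec coherent? Q →-dec coherent? C →-dec
  allHold? (patternAssignment P Q C) ∨-rules →-dec (decode C ≟ (decode P ⊔ decode Q)))

⇒-rules-iff : ∀ P Q C →
  AllHold (patternAssignment P Q C) ⇒-rules ⇔ (proj₁ C ≡ (not (proj₁ P) ∨ proj₁ Q))
⇒-rules-iff = from-yes (exhaustible-Profile λ P → exhaustible-Profile λ Q → exhaustible-Profile λ C →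
  allHold? (patternAssignment P Q C) ⇒-rules ⇔-dec (proj₁ C Bool.≟ (not (proj₁ P) ∨ proj₁ Q)))

-- Soundness

pqDeterministic : Fm → Bool
pqDeterministic (var zero) = true
pqDeterministic (var (suc zero)) = true
pqDeterministic (var (suc (suc _))) = false
pqDeterministic ⊥ᶠ = true
pqDeterministic ⊤ᶠ = true
pqDeterministic (∼ φ) = pqDeterministic φ
pqDeterministic (∘ φ) = pqDeterministic φ
pqDeterministic (φ ∧ᶠ ψ) = pqDeterministic φ ∧ pqDeterministic ψ
pqDeterministic (φ ∨ᶠ ψ) = pqDeterministic φ ∧ pqDeterministic ψ
pqDeterministic (φ ⇒ ψ) = false

-- The value of a pqDeterministic formula at p ↦ x, q ↦ y; junk on other formulas.
⟦_⟧ : Fm → V6 → V6 → V6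
⟦ var zero ⟧ x y = x
⟦ var (suc _) ⟧ x y = y
⟦ ⊥ᶠ ⟧ x y = f̂
⟦ ⊤ᶠ ⟧ x y = t̂
⟦ ∼ φ ⟧ x y = ∼ᵛ (⟦ φ ⟧ x y)
⟦ ∘ φ ⟧ x y = ∘ᵛ (⟦ φ ⟧ x y)
⟦ φ ∧ᶠ ψ ⟧ x y = ⟦ φ ⟧ x y ⊓ ⟦ ψ ⟧ x y
⟦ φ ∨ᶠ ψ ⟧ x y = ⟦ φ ⟧ x y ⊔ ⟦ ψ ⟧ x y
⟦ φ ⇒ ψ ⟧ x y = f̂

TablesValidate : Rule → Set
TablesValidate ρ =
  T (all pqDeterministic (Rule.prem ρ ++ Rule.conc ρ)) × (∀ x y → Holds (λ φ → inUpB (⟦ φ ⟧ x y)) ρ)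

tablesValidate? : ∀ ρ → Dec (TablesValidate ρ)
tablesValidate? ρ = T? _ ×-dec
  exhaustible-V6 (λ x → exhaustible-V6 λ y → holds? (λ φ → inUpB (⟦ φ ⟧ x y)) ρ)

⇒A1-designation : ∀ x y c → (x ⇒A1 y) c ⇔ (inUpB c ≡ (not (inUpB x) ∨ inUpB y))
⇒A1-designation x y c = lemma (not (inUpB x) ∨ inUpB y) (inUpB c)
  where
  lemma : ∀ g d → (if g then d ≡ true else ¬ d ≡ true) ⇔ (d ≡ g)
  lemma true d = mk⇔ id id
  lemma false true = mk⇔ (λ ¬d → ⊥-elim (¬d refl)) (λ ())
  lemma false false = mk⇔ (const refl) (const (λ ()))

module RuleSoundness {h : Fm → V6} (valuation : IsValuation h) where
  open IsValuation valuation

  E : Fm → Bool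
  E = inUpB ∘ h

  profile : Fm → Profile
  profile = profileUnder E

  eval-sub : ∀ σ φ → T (pqDeterministic φ) → h (sub σ φ) ≡ ⟦ φ ⟧ (h (σ 0)) (h (σ 1))
  eval-sub σ (var zero) _ = refl
  eval-sub σ (var (suc zero)) _ = refl
  eval-sub σ ⊥ᶠ _ = v-⊥
  eval-sub σ ⊤ᶠ _ = v-⊤
  eval-sub σ (∼ φ) det = trans (v-∼ _) (cong ∼ᵛ (eval-sub σ φ det))
  eval-sub σ (∘ φ) det = trans (v-∘ _) (cong ∘ᵛ (eval-sub σ φ det))
  eval-sub σ (φ ∧ᶠ ψ) det with Equivalence.to T-∧ det
  ... | detφ , detψ = trans (v-∧ _ _) (cong₂ _⊓_ (eval-sub σ φ detφ) (eval-sub σ ψ detψ))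
  eval-sub σ (φ ∨ᶠ ψ) det with Equivalence.to T-∧ det
  ... | detφ , detψ = trans (v-∨ _ _) (cong₂ _⊔_ (eval-sub σ φ detφ) (eval-sub σ ψ detψ))

  -- The hidden argument is discharged by normalising the finite check.
  sound-by-tables : ∀ r → {True (tablesValidate? (rulesR r))} → ∀ σ → Holds (E ∘ sub σ) (rulesR r)
  sound-by-tables r {validated} σ premises with toWitness validated
  ... | deterministic , valid with Allₚ.++⁻ (Rule.prem (rulesR r)) (all⁺ pqDeterministic _ deterministic)
  ... | deterministic-prem , deterministic-conc =
    subst T (cong or (sym (evaluate deterministic-conc)))
      (valid (h (σ 0)) (h (σ 1)) (subst T (cong and (evaluate deterministic-prem)) premises))
    where
    evaluate : ∀ {φs} → All (T ∘ pqDeterministic) φs →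
               map (E ∘ sub σ) φs ≡ map (λ φ → inUpB (⟦ φ ⟧ (h (σ 0)) (h (σ 1)))) φs
    evaluate = map-cong-local ∘ All.map (λ {φ} → cong inUpB ∘ eval-sub σ φ)

  ⇒-rules-sound : (σ : Subst) →
    AllHold (patternAssignment (profile (σ 0)) (profile (σ 1)) (profile (σ 0 ⇒ σ 1))) ⇒-rules
  ⇒-rules-sound σ =
    Equivalence.from (⇒-rules-iff (profile (σ 0)) (profile (σ 1)) (profile (σ 0 ⇒ σ 1)))
      (Equivalence.to (⇒A1-designation (h (σ 0)) (h (σ 1)) (h (σ 0 ⇒ σ 1))) (v-⇒ (σ 0) (σ 1)))

  rule-sound : ∀ r σ → Holds (E ∘ sub σ) (rulesR r)
  rule-sound i1 σ = All.lookup (⇒-rules-sound σ) (here refl)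
  rule-sound i2 σ = All.lookup (⇒-rules-sound σ) (there (here refl))
  rule-sound i3 σ = All.lookup (⇒-rules-sound σ) (there (there (here refl)))
  rule-sound r1 = sound-by-tables r1
  rule-sound r2 = sound-by-tables r2
  rule-sound r3 = sound-by-tables r3
  rule-sound r4 = sound-by-tables r4
  rule-sound r5 = sound-by-tables r5
  rule-sound r6 = sound-by-tables r6
  rule-sound r7 = sound-by-tables r7
  rule-sound r8 = sound-by-tables r8
  rule-sound r9 = sound-by-tables r9
  rule-sound r10 = sound-by-tables r10
  rule-sound r11 = sound-by-tables r11
  rule-sound r12 = sound-by-tables r12
  rule-sound r13 = sound-by-tables r13
  rule-sound r14 = sound-by-tables r14
  rule-sound r15 = sound-by-tables r15
  rule-sound r16 = sound-by-tables r16
  rule-sound r17 = sound-by-tables r17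
  rule-sound r18 = sound-by-tables r18
  rule-sound r19 = sound-by-tables r19
  rule-sound r20 = sound-by-tables r20
  rule-sound r21 = sound-by-tables r21
  rule-sound r22 = sound-by-tables r22
  rule-sound r23 = sound-by-tables r23
  rule-sound r24 = sound-by-tables r24
  rule-sound r25 = sound-by-tables r25
  rule-sound r26 = sound-by-tables r26
  rule-sound r27 = sound-by-tables r27
  rule-sound r28 = sound-by-tables r28
  rule-sound r29 = sound-by-tables r29
  rule-sound r30 = sound-by-tables r30
  rule-sound r31 = sound-by-tables r31
  rule-sound r32 = sound-by-tables r32
  rule-sound r33 = sound-by-tables r33
  rule-sound r34 = sound-by-tables r34
  rule-sound r35 = sound-by-tables r35
  rule-sound r36 = sound-by-tables r36
  rule-sound r37 = sound-by-tables r37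

soundness : ∀ {Λ Φ Ψ} → Derivable R Λ Φ Ψ → Φ ▷M Ψ
soundness d h valuation with derivable-sound (inUpB ∘ h) (RuleSoundness.rule-sound valuation) d
... | inj₁ (φ , Φφ , undesignated) = inj₁ (φ , Φφ , undesignated ∘ Equivalence.from T-≡)
... | inj₂ (ψ , Ψψ , designated) = inj₂ (ψ , Ψψ , Equivalence.to T-≡ designated)

-- Completeness

≼-trans : ∀ {φ ψ χ} → φ ≼ ψ → ψ ≼ χ → φ ≼ χ
≼-trans φ≼ψ ≼-refl = φ≼ψ
≼-trans φ≼ψ (≼-∼ ψ≼χ) = ≼-∼ (≼-trans φ≼ψ ψ≼χ)
≼-trans φ≼ψ (≼-∘ ψ≼χ) = ≼-∘ (≼-trans φ≼ψ ψ≼χ)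
≼-trans φ≼ψ (≼-∧ˡ ψ≼χ) = ≼-∧ˡ (≼-trans φ≼ψ ψ≼χ)
≼-trans φ≼ψ (≼-∧ʳ ψ≼χ) = ≼-∧ʳ (≼-trans φ≼ψ ψ≼χ)
≼-trans φ≼ψ (≼-∨ˡ ψ≼χ) = ≼-∨ˡ (≼-trans φ≼ψ ψ≼χ)
≼-trans φ≼ψ (≼-∨ʳ ψ≼χ) = ≼-∨ʳ (≼-trans φ≼ψ ψ≼χ)
≼-trans φ≼ψ (≼-⇒ˡ ψ≼χ) = ≼-⇒ˡ (≼-trans φ≼ψ ψ≼χ)
≼-trans φ≼ψ (≼-⇒ʳ ψ≼χ) = ≼-⇒ʳ (≼-trans φ≼ψ ψ≼χ)

pq≔ : Fm → Fm → Subst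
pq≔ φ ψ zero = φ
pq≔ φ ψ (suc _) = ψ

choose : Bool → V6 → V6
choose g v = if g then (if inUpB v then v else t) else (if inUpB v then f else v)

choose-designation : ∀ g v → inUpB (choose g v) ≡ g
choose-designation = from-yes (exhaustible-Bool λ g → exhaustible-V6 λ v → inUpB (choose g v) Bool.≟ g)

choose-self : ∀ v → choose (inUpB v) v ≡ v
choose-self = from-yes (exhaustible-V6 λ v → choose (inUpB v) v ≟ v)

module Canonical (em : ExcludedMiddle 0ℓ) (Φ Ψ : FmSet)
                 (Φ⊬Ψ : ¬ Derivable R (Υ Ξ (Φ ∪ Ψ)) Φ Ψ) where

  Λ : FmSet
  Λ = Υ Ξ (Φ ∪ Ψ)

  open LeftSide em (Lindenbaum.lindenbaum em R Λ Φ Ψ Φ⊬Ψ)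

  Sub : FmSet
  Sub χ = ∃ λ ψ → (Φ ∪ Ψ) ψ × χ ≼ ψ

  Sub-≼ : ∀ {χ χ'} → χ ≼ χ' → Sub χ' → Sub χ
  Sub-≼ χ≼χ' (ψ , Φ∪Ψψ , χ'≼ψ) = ψ , Φ∪Ψψ , ≼-trans χ≼χ' χ'≼ψ

  Λ-self : ∀ {χ} → Sub χ → Λ χ
  Λ-self = inj₁

  Λ-∼ : ∀ {χ} → Sub χ → Λ (∼ χ)
  Λ-∼ {χ} s = inj₂ (∼ p , there (here refl) , const χ , const s , refl)

  Λ-∘ : ∀ {χ} → Sub χ → Λ (∘ χ)
  Λ-∘ {χ} s = inj₂ (∘ p , there (there (here refl)) , const χ , const s , refl)

  profile : Fm → Profile
  profile = profileUnder onLeft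

  coherent : ∀ {χ} → Sub χ → Coherent (profile χ)
  coherent {χ} s =
    onLeft-respects r24 (pq≔ χ χ) (Λ-self s ∷ Λ-∼ s ∷ []) ∷ onLeft-respects r25 (pq≔ χ χ) [] ∷ []

  ⊥-respected : Sub ⊥ᶠ →
    AllHold (patternAssignment (profile ⊥ᶠ) (profile ⊥ᶠ) (profile ⊥ᶠ)) (r4 ∷ r19 ∷ [])
  ⊥-respected s = onLeft-respects r4 var [] ∷ onLeft-respects r19 var (Λ-∘ s ∷ []) ∷ []

  ⊤-respected : Sub ⊤ᶠ →
    AllHold (patternAssignment (profile ⊤ᶠ) (profile ⊤ᶠ) (profile ⊤ᶠ)) (r1 ∷ r20 ∷ [])
  ⊤-respected s =
    onLeft-respects r1 var (Λ-self s ∷ []) ∷ onLeft-respects r20 var (Λ-∘ s ∷ []) ∷ []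

  ∼-respected : ∀ {φ} → Sub (∼ φ) →
    AllHold (patternAssignment (profile φ) (profile φ) (profile (∼ φ))) ∼-rules
  ∼-respected {φ} s =
    respects r5 (Λ-∼ s ∷ []) ∷ respects r6 (Λ-self sφ ∷ []) ∷
    respects r22 (Λ-∘ s ∷ []) ∷ respects r23 (Λ-∘ sφ ∷ []) ∷ []
    where
    sφ = Sub-≼ (≼-∼ ≼-refl) s
    respects = λ r → onLeft-respects r (pq≔ φ φ)

  ∘-respected : ∀ {φ} → Sub (∘ φ) →
    AllHold (patternAssignment (profile φ) (profile φ) (profile (∘ φ))) (r21 ∷ [])
  ∘-respected {φ} s = onLeft-respects r21 (pq≔ φ φ) (Λ-∘ s ∷ []) ∷ []

  ∧-respected : ∀ {φ ψ} → Sub (φ ∧ᶠ ψ) →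
    AllHold (patternAssignment (profile φ) (profile ψ) (profile (φ ∧ᶠ ψ))) ∧-rules
  ∧-respected {φ} {ψ} s =
    respects r7 (Λ-self sφ ∷ []) ∷ respects r8 (Λ-self sψ ∷ []) ∷ respects r9 (Λ-self s ∷ []) ∷
    respects r10 (Λ-∼ s ∷ []) ∷ respects r11 (Λ-∼ s ∷ []) ∷ respects r12 (Λ-∼ sφ ∷ Λ-∼ sψ ∷ []) ∷
    respects r26 (Λ-∘ s ∷ Λ-self sφ ∷ []) ∷ respects r27 (Λ-∘ s ∷ Λ-self sψ ∷ []) ∷
    respects r28 (Λ-∘ sφ ∷ []) ∷ respects r29 (Λ-∘ sψ ∷ []) ∷
    respects r30 (Λ-∘ s ∷ []) ∷ respects r31 (Λ-∘ sφ ∷ Λ-∘ sψ ∷ []) ∷ []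
    where
    sφ = Sub-≼ (≼-∧ˡ ≼-refl) s
    sψ = Sub-≼ (≼-∧ʳ ≼-refl) s
    respects = λ r → onLeft-respects r (pq≔ φ ψ)

  ∨-respected : ∀ {φ ψ} → Sub (φ ∨ᶠ ψ) →
    AllHold (patternAssignment (profile φ) (profile ψ) (profile (φ ∨ᶠ ψ))) ∨-rules
  ∨-respected {φ} {ψ} s =
    respects r13 (Λ-self s ∷ []) ∷ respects r14 (Λ-self s ∷ []) ∷
    respects r15 (Λ-self sφ ∷ Λ-self sψ ∷ []) ∷
    respects r16 (Λ-∼ s ∷ []) ∷ respects r17 (Λ-∼ sφ ∷ []) ∷ respects r18 (Λ-∼ sψ ∷ []) ∷
    respects r32 (Λ-∘ s ∷ []) ∷ respects r33 (Λ-∘ sφ ∷ Λ-∘ sψ ∷ []) ∷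
    respects r34 (Λ-∘ s ∷ []) ∷ respects r35 (Λ-∘ s ∷ []) ∷
    respects r36 (Λ-∘ sφ ∷ Λ-self sψ ∷ []) ∷ respects r37 (Λ-∘ sψ ∷ Λ-self sφ ∷ []) ∷ []
    where
    sφ = Sub-≼ (≼-∨ˡ ≼-refl) s
    sψ = Sub-≼ (≼-∨ʳ ≼-refl) s
    respects = λ r → onLeft-respects r (pq≔ φ ψ)

  ⇒-respected : ∀ {φ ψ} → Sub (φ ⇒ ψ) →
    AllHold (patternAssignment (profile φ) (profile ψ) (profile (φ ⇒ ψ))) ⇒-rules
  ⇒-respected {φ} {ψ} s =
    respects i1 (Λ-self s ∷ []) ∷ respects i2 (Λ-self sφ ∷ Λ-self s ∷ []) ∷
    respects i3 (Λ-self sψ ∷ []) ∷ []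
    where
    sφ = Sub-≼ (≼-⇒ˡ ≼-refl) s
    sψ = Sub-≼ (≼-⇒ʳ ≼-refl) s
    respects = λ r → onLeft-respects r (pq≔ φ ψ)

  h : Fm → V6
  h (var x) = decode (profile (var x))
  h ⊥ᶠ = f̂
  h ⊤ᶠ = t̂
  h (∼ φ) = ∼ᵛ (h φ)
  h (∘ φ) = ∘ᵛ (h φ)
  h (φ ∧ᶠ ψ) = h φ ⊓ h ψ
  h (φ ∨ᶠ ψ) = h φ ⊔ h ψ
  h (φ ⇒ ψ) = choose (not (inUpB (h φ)) ∨ inUpB (h ψ)) (decode (profile (φ ⇒ ψ)))

  h-valuation : IsValuation h
  h-valuation = record
    { v-⊥ = refl ; v-⊤ = refl ; v-∼ = λ _ → refl ; v-∘ = λ _ → refl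
    ; v-∧ = λ _ _ → refl ; v-∨ = λ _ _ → refl
    ; v-⇒ = λ φ ψ → Equivalence.from (⇒A1-designation (h φ) (h ψ) _)
                                     (choose-designation _ (decode (profile (φ ⇒ ψ))))
    }

  h-decodes : ∀ χ → Sub χ → h χ ≡ decode (profile χ)
  h-designates-onLeft : ∀ χ → Sub χ → inUpB (h χ) ≡ onLeft χ

  h-decodes (var x) s = refl
  h-decodes ⊥ᶠ s = sym (⊥-rules-force _ (⊥-respected s))
  h-decodes ⊤ᶠ s = sym (⊤-rules-force _ (⊤-respected s))
  h-decodes (∼ φ) s = begin
    ∼ᵛ (h φ)                 ≡⟨ cong ∼ᵛ (h-decodes φ sφ) ⟩
    ∼ᵛ (decode (profile φ))  ≡⟨ sym (∼-rules-force _ _ _ _ _ (coherent sφ) (∼-respected s)) ⟩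
    decode (profile (∼ φ))   ∎
    where
    open ≡-Reasoning
    sφ = Sub-≼ (≼-∼ ≼-refl) s
  h-decodes (∘ φ) s = begin
    ∘ᵛ (h φ)                 ≡⟨ cong ∘ᵛ (h-decodes φ (Sub-≼ (≼-∘ ≼-refl) s)) ⟩
    ∘ᵛ (decode (profile φ))  ≡⟨ sym (∘-rules-force _ _ _ _ _ (∘-respected s)) ⟩
    decode (profile (∘ φ))   ∎
    where open ≡-Reasoning
  h-decodes (φ ∧ᶠ ψ) s = begin
    h φ ⊓ h ψ
      ≡⟨ cong₂ _⊓_ (h-decodes φ sφ) (h-decodes ψ sψ) ⟩
    decode (profile φ) ⊓ decode (profile ψ)
      ≡⟨ sym (∧-rules-force _ _ _ (coherent sφ) (coherent sψ) (coherent s) (∧-respected s)) ⟩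
    decode (profile (φ ∧ᶠ ψ)) ∎
    where
    open ≡-Reasoning
    sφ = Sub-≼ (≼-∧ˡ ≼-refl) s
    sψ = Sub-≼ (≼-∧ʳ ≼-refl) s
  h-decodes (φ ∨ᶠ ψ) s = begin
    h φ ⊔ h ψ
      ≡⟨ cong₂ _⊔_ (h-decodes φ sφ) (h-decodes ψ sψ) ⟩
    decode (profile φ) ⊔ decode (profile ψ)
      ≡⟨ sym (∨-rules-force _ _ _ (coherent sφ) (coherent sψ) (coherent s) (∨-respected s)) ⟩
    decode (profile (φ ∨ᶠ ψ)) ∎
    where
    open ≡-Reasoning
    sφ = Sub-≼ (≼-∨ˡ ≼-refl) s
    sψ = Sub-≼ (≼-∨ʳ ≼-refl) s
  h-decodes (φ ⇒ ψ) s = begin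
    choose (not (inUpB (h φ)) ∨ inUpB (h ψ)) (decode (profile (φ ⇒ ψ)))
      ≡⟨ cong (λ g → choose g (decode (profile (φ ⇒ ψ)))) designation ⟩
    choose (inUpB (decode (profile (φ ⇒ ψ)))) (decode (profile (φ ⇒ ψ)))
      ≡⟨ choose-self (decode (profile (φ ⇒ ψ))) ⟩
    decode (profile (φ ⇒ ψ)) ∎
    where
    open ≡-Reasoning
    designation : not (inUpB (h φ)) ∨ inUpB (h ψ) ≡ inUpB (decode (profile (φ ⇒ ψ)))
    designation = begin
      not (inUpB (h φ)) ∨ inUpB (h ψ)
        ≡⟨ cong₂ (λ x y → not x ∨ y) (h-designates-onLeft φ (Sub-≼ (≼-⇒ˡ ≼-refl) s))
                                     (h-designates-onLeft ψ (Sub-≼ (≼-⇒ʳ ≼-refl) s)) ⟩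
      not (onLeft φ) ∨ onLeft ψ
        ≡⟨ sym (Equivalence.to (⇒-rules-iff (profile φ) (profile ψ) (profile (φ ⇒ ψ))) (⇒-respected s)) ⟩
      onLeft (φ ⇒ ψ)
        ≡⟨ sym (decode-designation (profile (φ ⇒ ψ))) ⟩
      inUpB (decode (profile (φ ⇒ ψ))) ∎

  h-designates-onLeft χ s = trans (cong inUpB (h-decodes χ s)) (decode-designation (profile χ))

  h-refutes : ¬ ((∃ λ φ → Φ φ × ¬ UpB (h φ)) ⊎ (∃ λ ψ → Ψ ψ × UpB (h ψ)))
  h-refutes (inj₁ (φ , Φφ , undesignated)) =
    undesignated (trans (h-designates-onLeft φ sφ)
                        (Equivalence.to T-≡ (left⇒onLeft (Φ⊆left Φφ , Λ-self sφ))))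
    where sφ = φ , inj₁ Φφ , ≼-refl
  h-refutes (inj₂ (ψ , Ψψ , designated)) =
    underivable (ψ ∷ [] , proj₁ (onLeft⇒left ψ-onLeft) ∷ [] , Λ-self sψ ∷ [] ,
                 leaf (here refl) (Ψ⊆right Ψψ))
    where
    sψ = ψ , inj₂ Ψψ , ≼-refl
    ψ-onLeft = Equivalence.from T-≡ (trans (sym (h-designates-onLeft ψ sψ)) designated)

analytic-completeness : ExcludedMiddle 0ℓ → ∀ Φ Ψ → Φ ▷M Ψ → Derivable R (Υ Ξ (Φ ∪ Ψ)) Φ Ψ
analytic-completeness em Φ Ψ valid with em {Derivable R (Υ Ξ (Φ ∪ Ψ)) Φ Ψ}
... | yes derivable = derivable
... | no Φ⊬Ψ = ⊥-elim (h-refutes (valid h h-valuation))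
  where open Canonical em Φ Ψ Φ⊬Ψ

theorem4p4 : ExcludedMiddle 0ℓ →
    Analytic R Ξ ×
    (∀ (Φ Ψ : FmSet) → (Φ ⊢[ R ] Ψ → Φ ▷M Ψ) × (Φ ▷M Ψ → Φ ⊢[ R ] Ψ))
theorem4p4 em =
  (λ Φ Ψ → analytic-completeness em Φ Ψ ∘ soundness) ,
  (λ Φ Ψ → soundness , derivable-mono (const tt) id id ∘ analytic-completeness em Φ Ψ)
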